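{- For every integer $k>0$, the graph $G = kC_3 \cup 2K_1$ (the disjoint union of $k$ triangles and two isolated vertices, so $G$ has $n = 3k+2$ vertices) admits a good permutation, i.e. a permutation $\sigma$ of $V(G)$ such that: (i) for every edge $uv \in E(G)$, $\sigma(u)\sigma(v) \notin E(G)$; (ii) the cyclic decomposition of $\sigma$ has at least $\lfloor 2n/3 \rfloor$ cycles (fixed points counted as cycles of length one); (iii) every cycle of $\sigma$ has length at most $2$, i.e. for all distinct $u,v \in V(G)$, $\sigma(u)=v$ implies $\sigma(v)=u$.
   Context: Graphs are finite, simple and undirected. $C_3$ denotes the triangle, $K_1$ a single vertex, and $kC_3\cup 2K_1$ the vertex-disjoint union of $k$ copies of $C_3$ and two copies of $K_1$. A permutation $\sigma$ of $V(G)$ is written as a disjoint union of cycles (its cyclic decomposition); cycles of length one are the fixed points. -}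

module Defs where

open import Data.Nat.Base using (_≤_; ℕ; zero; suc; _+_; _*_; _<_; _≤ᵇ_; _/_)
open import Data.Fin.Base using (Fin; toℕ)
open import Data.Fin.Permutation using (Permutation′; _⟨$⟩ʳ_)
open import Data.List.Base using (List; length; filterᵇ; all; upTo; allFin)
open import Data.Bool.Base using (Bool)
open import Data.Product.Base using (_×_)
open import Relation.Binary.PropositionalEquality using (_≡_; _≢_)
open import Relation.Nullary.Negation using (¬_)

-- Vertex set of  k C₃ ∪ 2 K₁ : Fin (3k+2).
-- Vertices 0..3k-1 form the k triangles {3j, 3j+1, 3j+2};
-- vertices 3k and 3k+1 are the two isolated vertices.
numVertices : ℕ → ℕ
numVertices k = 3 * k + 2

Adj : (k : ℕ) → Fin (numVertices k) → Fin (numVertices k) → Set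
Adj k u v = (u ≢ v) × (toℕ u < 3 * k) × (toℕ v < 3 * k) × (toℕ u / 3 ≡ toℕ v / 3)

iter : ∀ {n} → Permutation′ n → ℕ → Fin n → Fin n
iter σ zero v = v
iter σ (suc i) v = σ ⟨$⟩ʳ (iter σ i v)

isCycleMin : ∀ {n} → Permutation′ n → Fin n → Bool
isCycleMin {n} σ v = all (λ i → toℕ v ≤ᵇ toℕ (iter σ i v)) (upTo n)

-- number of cycles in the cyclic decomposition of σ (fixed points included):
-- each cycle is counted once, via its least element.
numCycles : ∀ {n} → Permutation′ n → ℕ
numCycles {n} σ = length (filterᵇ (isCycleMin σ) (allFin n))

IsGoodPerm : (k : ℕ) → Permutation′ (numVertices k) → Set
IsGoodPerm k σ =
  (∀ u v → Adj k u v → ¬ Adj k (σ ⟨$⟩ʳ u) (σ ⟨$⟩ʳ v))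
  × ((2 * numVertices k) / 3 ≤ numCycles σ)
  × (∀ u v → u ≢ v → σ ⟨$⟩ʳ u ≡ v → σ ⟨$⟩ʳ v ≡ u)

-- The involution σ swaps 0 with 3k+1 and 3q+1 with 3q+3 for every
-- q < k, and fixes every 3q+2.  It moves the three corners of triangle q into the
-- three different blocks q-1, q+1 and q, so no edge is mapped onto an edge; and
-- having k fixed points and k+1 transpositions it has 2k+1 = ⌊2(3k+2)/3⌋ cycles.
module Submission where

open import Defs
open import Data.Nat.Base using (ℕ; _>_)
open import Data.Fin.Permutation using (Permutation′)
open import Data.Product.Base using (Σ)

open import Data.Bool.Base using (Bool; true; false; T)
open import Data.Fin.Base as Fin using (Fin; toℕ; fromℕ<)
open import Data.Fin.Permutation using (permutation; _⟨$⟩ʳ_)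
open import Data.Fin.Properties using (toℕ-fromℕ<; toℕ-injective; toℕ<n)
open import Data.List.Base
  using ([]; _∷_; _++_; [_]; length; map; filterᵇ; upTo; applyUpTo; allFin; tabulate)
open import Data.List.Properties using (length-++; filter-++; filter-accept; upTo-∷ʳ; map-tabulate; map-upTo)
open import Data.List.Relation.Binary.Sublist.Propositional using (⊆-refl)
open import Data.List.Relation.Binary.Sublist.Propositional.Properties using (filter⁺; length-mono-≤)
open import Data.List.Relation.Unary.All.Properties using (all⁻; applyUpTo⁺₂)
open import Data.Nat.Base using (zero; suc; _+_; _*_; _≤_; _<_; _≤ᵇ_; _/_; _%_; z≤n; s≤s; s≤s⁻¹)
open import Data.Nat.Divisibility using (n∣m*n)
open import Data.Nat.DivMod using (m≡m%n+[m/n]*n; +-distrib-/-∣ʳ; m<n⇒m/n≡0; m*n/n≡m; m%n<n)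
open import Data.Nat.Properties
open import Data.Nat.Tactic.RingSolver using (solve-∀)
open import Data.Product.Base using (_,_; _×_; proj₁; proj₂)
open import Data.Sum.Base using (_⊎_; inj₁; inj₂)
open import Function.Base using (_∘_; id)
open import Relation.Binary.PropositionalEquality hiding ([_])
open import Relation.Nullary.Decidable using (yes; no; T?)
open import Relation.Nullary.Negation using (¬_; contradiction)

count-mono : ∀ {A : Set} {p q : A → Bool} → (∀ x → T (p x) → T (q x)) →
             ∀ xs → length (filterᵇ p xs) ≤ length (filterᵇ q xs)
count-mono {p = p} {q} p⇒q xs =
  length-mono-≤ (filter⁺ (T? ∘ p) (T? ∘ q) (λ { refl → p⇒q _ }) (⊆-refl {x = xs}))

count-map : ∀ {A B : Set} (p : B → Bool) (f : A → B) xs →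
            length (filterᵇ p (map f xs)) ≡ length (filterᵇ (p ∘ f) xs)
count-map p f [] = refl
count-map p f (x ∷ xs) with p (f x)
... | true  = cong suc (count-map p f xs)
... | false = count-map p f xs

map-toℕ-allFin : ∀ n → map toℕ (allFin n) ≡ upTo n
map-toℕ-allFin zero = refl
map-toℕ-allFin (suc n) = cong (0 ∷_) (begin
  map toℕ (tabulate Fin.suc)  ≡⟨ map-tabulate Fin.suc toℕ ⟩
  tabulate (suc ∘ toℕ)        ≡⟨ map-tabulate toℕ suc ⟨
  map suc (tabulate toℕ)      ≡⟨ cong (map suc) (trans (sym (map-tabulate id toℕ)) (map-toℕ-allFin n)) ⟩
  map suc (upTo n)            ≡⟨ map-upTo suc n ⟩
  applyUpTo suc n             ∎)
  where open ≡-Reasoning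

countBelow : (ℕ → Bool) → ℕ → ℕ
countBelow p n = length (filterᵇ p (upTo n))

countBelow-suc : ∀ p n → countBelow p (suc n) ≡ countBelow p n + length (filterᵇ p [ n ])
countBelow-suc p n = begin
  length (filterᵇ p (upTo (suc n)))                   ≡⟨ cong (length ∘ filterᵇ p) (upTo-∷ʳ n) ⟨
  length (filterᵇ p (upTo n ++ [ n ]))                ≡⟨ cong length (filter-++ (T? ∘ p) (upTo n) [ n ]) ⟩
  length (filterᵇ p (upTo n) ++ filterᵇ p [ n ])      ≡⟨ length-++ (filterᵇ p (upTo n)) ⟩
  countBelow p n + length (filterᵇ p [ n ])           ∎
  where open ≡-Reasoning

countBelow-mono-suc : ∀ p n → countBelow p n ≤ countBelow p (suc n)
countBelow-mono-suc p n = subst (countBelow p n ≤_) (sym (countBelow-suc p n)) (m≤m+n _ _)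

countBelow-accept : ∀ p {n} → T (p n) → suc (countBelow p n) ≤ countBelow p (suc n)
countBelow-accept p {n} pn = ≤-reflexive (begin
  suc (countBelow p n)                       ≡⟨ +-comm 1 (countBelow p n) ⟩
  countBelow p n + 1                         ≡⟨ cong (λ l → countBelow p n + length l) (filter-accept (T? ∘ p) pn) ⟨
  countBelow p n + length (filterᵇ p [ n ])  ≡⟨ countBelow-suc p n ⟨
  countBelow p (suc n)                       ∎)
  where open ≡-Reasoning

countBelow-triangles : ∀ p m → T (p 0) → (∀ {j} → j < m → T (p (1 + j * 3)) × T (p (2 + j * 3))) →
                       suc (m * 2) ≤ countBelow p (1 + m * 3)
countBelow-triangles p zero p0 _ = countBelow-accept p p0
countBelow-triangles p (suc m) p0 inside = begin
  3 + m * 2                    ≤⟨ s≤s (s≤s (countBelow-triangles p m p0 (inside ∘ m<n⇒m<1+n))) ⟩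
  2 + countBelow p (1 + m * 3) ≤⟨ s≤s (countBelow-accept p p[1+3m]) ⟩
  1 + countBelow p (2 + m * 3) ≤⟨ countBelow-accept p p[2+3m] ⟩
  countBelow p (3 + m * 3)     ≤⟨ countBelow-mono-suc p _ ⟩
  countBelow p (4 + m * 3)     ∎
  where
  open ≤-Reasoning
  p[1+3m] : T (p (1 + m * 3))
  p[1+3m] = proj₁ (inside ≤-refl)
  p[2+3m] : T (p (2 + m * 3))
  p[2+3m] = proj₂ (inside ≤-refl)

module _ {n} (σ : Permutation′ n) (σ-involutive : ∀ v → σ ⟨$⟩ʳ (σ ⟨$⟩ʳ v) ≡ v) where

  iter-involution : ∀ i v → iter σ i v ≡ v ⊎ iter σ i v ≡ σ ⟨$⟩ʳ v
  iter-involution zero v = inj₁ refl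
  iter-involution (suc i) v with iter-involution i v
  ... | inj₁ σⁱv≡v  = inj₂ (cong (σ ⟨$⟩ʳ_) σⁱv≡v)
  ... | inj₂ σⁱv≡σv = inj₁ (trans (cong (σ ⟨$⟩ʳ_) σⁱv≡σv) (σ-involutive v))

  isCycleMin-involution : ∀ v → toℕ v ≤ toℕ (σ ⟨$⟩ʳ v) → T (isCycleMin σ v)
  isCycleMin-involution v v≤σv = all⁻ _ (applyUpTo⁺₂ id n v≤σⁱv)
    where
    v≤σⁱv : ∀ i → T (toℕ v ≤ᵇ toℕ (iter σ i v))
    v≤σⁱv i with iter-involution i v
    ... | inj₁ σⁱv≡v  = ≤⇒≤ᵇ (≤-reflexive (cong toℕ (sym σⁱv≡v)))
    ... | inj₂ σⁱv≡σv = ≤⇒≤ᵇ (subst (λ w → toℕ v ≤ toℕ w) (sym σⁱv≡σv) v≤σv)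

module Involution {n} (f : ℕ → ℕ) (f-< : ∀ {x} → x < n → f x < n)
                  (f-involutive : ∀ {x} → x < n → f (f x) ≡ x) where

  restriction : Fin n → Fin n
  restriction i = fromℕ< (f-< (toℕ<n i))

  toℕ-restriction : ∀ i → toℕ (restriction i) ≡ f (toℕ i)
  toℕ-restriction i = toℕ-fromℕ< _

  restriction-involutive : ∀ i → restriction (restriction i) ≡ i
  restriction-involutive i = toℕ-injective (begin
    toℕ (restriction (restriction i)) ≡⟨ toℕ-restriction (restriction i) ⟩
    f (toℕ (restriction i))           ≡⟨ cong f (toℕ-restriction i) ⟩
    f (f (toℕ i))                     ≡⟨ f-involutive (toℕ<n i) ⟩
    toℕ i                             ∎)
    where open ≡-Reasoning

  restrictionPermutation : Permutation′ n
  restrictionPermutation = permutation restriction restriction restriction-involutive restriction-involutive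

  countBelow-≤-numCycles : countBelow (λ x → x ≤ᵇ f x) n ≤ numCycles restrictionPermutation
  countBelow-≤-numCycles = begin
    countBelow p n                               ≡⟨ cong (length ∘ filterᵇ p) (map-toℕ-allFin n) ⟨
    length (filterᵇ p (map toℕ (allFin n)))      ≡⟨ count-map p toℕ (allFin n) ⟩
    length (filterᵇ (p ∘ toℕ) (allFin n))        ≤⟨ count-mono isCycleMin-restriction (allFin n) ⟩
    numCycles restrictionPermutation             ∎
    where
    open ≤-Reasoning
    p : ℕ → Bool
    p x = x ≤ᵇ f x
    isCycleMin-restriction : ∀ v → T (p (toℕ v)) → T (isCycleMin restrictionPermutation v)
    isCycleMin-restriction v pv = isCycleMin-involution restrictionPermutation restriction-involutive v
      (subst (toℕ v ≤_) (sym (toℕ-restriction v)) (≤ᵇ⇒≤ _ _ pv))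

flipTriples : ℕ → ℕ
flipTriples 0 = 2
flipTriples 1 = 1
flipTriples 2 = 0
flipTriples (suc (suc (suc x))) = 3 + flipTriples x

flipTriples-involutive : ∀ x → flipTriples (flipTriples x) ≡ x
flipTriples-involutive 0 = refl
flipTriples-involutive 1 = refl
flipTriples-involutive 2 = refl
flipTriples-involutive (suc (suc (suc x))) = cong (3 +_) (flipTriples-involutive x)

flipTriples-< : ∀ q {x} → x < q * 3 → flipTriples x < q * 3
flipTriples-< (suc q) {0} _ = s≤s (s≤s (s≤s z≤n))
flipTriples-< (suc q) {1} _ = s≤s (s≤s z≤n)
flipTriples-< (suc q) {2} _ = s≤s z≤n
flipTriples-< (suc q) {suc (suc (suc x))} (s≤s (s≤s (s≤s x<3q))) = s≤s (s≤s (s≤s (flipTriples-< q x<3q)))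

flipTriples-first : ∀ q → flipTriples (q * 3) ≡ 2 + q * 3
flipTriples-first zero = refl
flipTriples-first (suc q) = cong (3 +_) (flipTriples-first q)

flipTriples-second : ∀ q → flipTriples (1 + q * 3) ≡ 1 + q * 3
flipTriples-second zero = refl
flipTriples-second (suc q) = cong (3 +_) (flipTriples-second q)

flipTriples-third : ∀ q → flipTriples (2 + q * 3) ≡ q * 3
flipTriples-third zero = refl
flipTriples-third (suc q) = cong (3 +_) (flipTriples-third q)

[r+q*3]/3≡q : ∀ {r} q → r < 3 → (r + q * 3) / 3 ≡ q
[r+q*3]/3≡q {r} q r<3 = begin
  (r + q * 3) / 3     ≡⟨ +-distrib-/-∣ʳ r (n∣m*n q) ⟩
  r / 3 + q * 3 / 3   ≡⟨ cong₂ _+_ (m<n⇒m/n≡0 r<3) (m*n/n≡m q 3) ⟩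
  q                   ∎
  where open ≡-Reasoning

goodMap : ℕ → ℕ → ℕ
goodMap k zero = suc (3 * k)
goodMap k (suc x) with x <? 3 * k
... | yes _ = suc (flipTriples x)
... | no _  = zero

goodMap-isolated : ∀ k → goodMap k (suc (3 * k)) ≡ zero
goodMap-isolated k with 3 * k <? 3 * k
... | yes 3k<3k = contradiction 3k<3k (<-irrefl refl)
... | no _      = refl

goodMap-inner : ∀ k {x} → x < 3 * k → goodMap k (suc x) ≡ suc (flipTriples x)
goodMap-inner k {x} x<3k with x <? 3 * k
... | yes _    = refl
... | no x≮3k  = contradiction x<3k x≮3k

flipTriples-<3* : ∀ k {x} → x < 3 * k → flipTriples x < 3 * k
flipTriples-<3* k rewrite *-comm 3 k = flipTriples-< k

goodMap-≤ : ∀ k x → goodMap k x ≤ suc (3 * k)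
goodMap-≤ k zero = ≤-refl
goodMap-≤ k (suc x) with x <? 3 * k
... | yes x<3k = s≤s (<⇒≤ (flipTriples-<3* k x<3k))
... | no _     = z≤n

goodMap-involutive : ∀ k {x} → x ≤ suc (3 * k) → goodMap k (goodMap k x) ≡ x
goodMap-involutive k {zero} _ = goodMap-isolated k
goodMap-involutive k {suc x} x<1+3k with x <? 3 * k
... | yes x<3k = trans (goodMap-inner k (flipTriples-<3* k x<3k)) (cong suc (flipTriples-involutive x))
... | no x≮3k  = cong suc (≤-antisym (≮⇒≥ x≮3k) (s≤s⁻¹ x<1+3k))

goodMap-first : ∀ k q → suc q * 3 < 3 * k → goodMap k (suc q * 3) ≡ 1 + q * 3
goodMap-first k q a<3k = trans (goodMap-inner k (<-trans (n<1+n _) a<3k)) (cong suc (flipTriples-third q))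

goodMap-second : ∀ k q → 1 + q * 3 < 3 * k → goodMap k (1 + q * 3) ≡ suc q * 3
goodMap-second k q a<3k = trans (goodMap-inner k (<-trans (n<1+n _) a<3k)) (cong suc (flipTriples-first q))

goodMap-third : ∀ k q → 2 + q * 3 < 3 * k → goodMap k (2 + q * 3) ≡ 2 + q * 3
goodMap-third k q a<3k = trans (goodMap-inner k (<-trans (n<1+n _) a<3k)) (cong suc (flipTriples-second q))

-- Corner r of triangle q is sent to block q + offset r - 1, that is, to q-1, q+1, q for r = 0, 1, 2.
offset : ℕ → ℕ
offset 0 = 0
offset 1 = 2
offset _ = 1

offset-involutive : ∀ {r} → r < 3 → offset (offset r) ≡ r
offset-involutive {0} _ = refl
offset-involutive {1} _ = refl
offset-involutive {2} _ = refl
offset-involutive {suc (suc (suc _))} (s≤s (s≤s (s≤s ())))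

goodMap-block-corner : ∀ k r q → r < 3 → r + q * 3 < 3 * k → goodMap k (r + q * 3) < 3 * k →
                       suc (goodMap k (r + q * 3) / 3) ≡ q + offset r
goodMap-block-corner k 0 zero _ _ σ0<3k = contradiction σ0<3k (<-asym (n<1+n _))
goodMap-block-corner k 0 (suc q) _ a<3k _ = begin
  suc (goodMap k (suc q * 3) / 3)  ≡⟨ cong (λ y → suc (y / 3)) (goodMap-first k q a<3k) ⟩
  suc ((1 + q * 3) / 3)            ≡⟨ cong suc ([r+q*3]/3≡q q (s≤s (s≤s z≤n))) ⟩
  suc q                            ≡⟨ +-identityʳ (suc q) ⟨
  suc q + 0                        ∎
  where open ≡-Reasoning
goodMap-block-corner k 1 q _ a<3k _ = begin
  suc (goodMap k (1 + q * 3) / 3)  ≡⟨ cong (λ y → suc (y / 3)) (goodMap-second k q a<3k) ⟩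
  suc (suc q * 3 / 3)              ≡⟨ cong suc (m*n/n≡m (suc q) 3) ⟩
  suc (suc q)                      ≡⟨ +-comm 2 q ⟩
  q + 2                            ∎
  where open ≡-Reasoning
goodMap-block-corner k 2 q _ a<3k _ = begin
  suc (goodMap k (2 + q * 3) / 3)  ≡⟨ cong (λ y → suc (y / 3)) (goodMap-third k q a<3k) ⟩
  suc ((2 + q * 3) / 3)            ≡⟨ cong suc ([r+q*3]/3≡q q (s≤s (s≤s (s≤s z≤n)))) ⟩
  suc q                            ≡⟨ +-comm 1 q ⟩
  q + 1                            ∎
  where open ≡-Reasoning
goodMap-block-corner k (suc (suc (suc _))) q (s≤s (s≤s (s≤s ()))) _ _

goodMap-block : ∀ k {a} → a < 3 * k → goodMap k a < 3 * k → suc (goodMap k a / 3) ≡ a / 3 + offset (a % 3)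
goodMap-block k {a} = subst (λ x → x < 3 * k → goodMap k x < 3 * k → suc (goodMap k x / 3) ≡ a / 3 + offset (a % 3))
  (sym (m≡m%n+[m/n]*n a 3)) (goodMap-block-corner k (a % 3) (a / 3) (m%n<n a 3))

goodMap-separates-triangle : ∀ k {a b} → a < 3 * k → b < 3 * k → goodMap k a < 3 * k → goodMap k b < 3 * k →
                             a / 3 ≡ b / 3 → goodMap k a / 3 ≡ goodMap k b / 3 → a ≡ b
goodMap-separates-triangle k {a} {b} a<3k b<3k σa<3k σb<3k same-block same-image-block = begin
  a                  ≡⟨ m≡m%n+[m/n]*n a 3 ⟩
  a % 3 + a / 3 * 3  ≡⟨ cong₂ (λ r q → r + q * 3) same-position same-block ⟩
  b % 3 + b / 3 * 3  ≡⟨ m≡m%n+[m/n]*n b 3 ⟨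
  b                  ∎
  where
  open ≡-Reasoning
  same-offset : offset (a % 3) ≡ offset (b % 3)
  same-offset = +-cancelˡ-≡ (b / 3) _ _ (begin
    b / 3 + offset (a % 3)  ≡⟨ cong (_+ offset (a % 3)) same-block ⟨
    a / 3 + offset (a % 3)  ≡⟨ goodMap-block k a<3k σa<3k ⟨
    suc (goodMap k a / 3)   ≡⟨ cong suc same-image-block ⟩
    suc (goodMap k b / 3)   ≡⟨ goodMap-block k b<3k σb<3k ⟩
    b / 3 + offset (b % 3)  ∎)
  same-position : a % 3 ≡ b % 3
  same-position = begin
    a % 3                   ≡⟨ offset-involutive (m%n<n a 3) ⟨
    offset (offset (a % 3)) ≡⟨ cong offset same-offset ⟩
    offset (offset (b % 3)) ≡⟨ offset-involutive (m%n<n b 3) ⟩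
    b % 3                   ∎

<numVertices⇒≤ : ∀ k {x} → x < numVertices k → x ≤ suc (3 * k)
<numVertices⇒≤ k {x} x<n = s≤s⁻¹ (subst (x <_) (+-comm (3 * k) 2) x<n)

≤⇒<numVertices : ∀ k {x} → x ≤ suc (3 * k) → x < numVertices k
≤⇒<numVertices k {x} x≤ = subst (x <_) (+-comm 2 (3 * k)) (s≤s x≤)

module GoodPermutation (k : ℕ) = Involution (goodMap k)
  (λ {x} _ → ≤⇒<numVertices k (goodMap-≤ k x)) (λ x<n → goodMap-involutive k (<numVertices⇒≤ k x<n))

goodPermutation : ∀ k → Permutation′ (numVertices k)
goodPermutation = GoodPermutation.restrictionPermutation

goodPermutation-edges : ∀ k u v → Adj k u v → ¬ Adj k (goodPermutation k ⟨$⟩ʳ u) (goodPermutation k ⟨$⟩ʳ v)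
goodPermutation-edges k u v (u≢v , a<3k , b<3k , same-block) (_ , σa<3k , σb<3k , same-image-block) =
  u≢v (toℕ-injective (goodMap-separates-triangle k a<3k b<3k
    (subst (_< 3 * k) (toℕ-restriction u) σa<3k) (subst (_< 3 * k) (toℕ-restriction v) σb<3k) same-block
    (subst₂ (λ x y → x / 3 ≡ y / 3) (toℕ-restriction u) (toℕ-restriction v) same-image-block)))
  where open GoodPermutation k

goodPermutation-cycles : ∀ k → (2 * numVertices k) / 3 ≤ numCycles (goodPermutation k)
goodPermutation-cycles k = begin
  (2 * numVertices k) / 3          ≡⟨ cong (_/ 3) (2[3k+2]≡1+[2k+1]*3 k) ⟩
  (1 + suc (k * 2) * 3) / 3        ≡⟨ [r+q*3]/3≡q (suc (k * 2)) (s≤s (s≤s z≤n)) ⟩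
  suc (k * 2)                      ≤⟨ countBelow-triangles p k (≤⇒≤ᵇ (z≤n {goodMap k 0})) corners-counted ⟩
  countBelow p (1 + k * 3)         ≤⟨ countBelow-mono-suc p _ ⟩
  countBelow p (2 + k * 3)         ≡⟨ cong (countBelow p) (2+k*3≡3k+2 k) ⟩
  countBelow p (numVertices k)     ≤⟨ countBelow-≤-numCycles ⟩
  numCycles (goodPermutation k)    ∎
  where
  open ≤-Reasoning
  open GoodPermutation k
  p : ℕ → Bool
  p x = x ≤ᵇ goodMap k x
  2[3k+2]≡1+[2k+1]*3 : ∀ k → 2 * (3 * k + 2) ≡ 1 + suc (k * 2) * 3
  2[3k+2]≡1+[2k+1]*3 = solve-∀
  2+k*3≡3k+2 : ∀ k → 2 + k * 3 ≡ 3 * k + 2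
  2+k*3≡3k+2 = solve-∀
  corners-counted : ∀ {j} → j < k → T (p (1 + j * 3)) × T (p (2 + j * 3))
  corners-counted {j} j<k =
      ≤⇒≤ᵇ (subst (1 + j * 3 ≤_) (sym (goodMap-second k j (<-trans (n<1+n _) third<3k))) (m≤n+m _ 2))
    , ≤⇒≤ᵇ (≤-reflexive (sym (goodMap-third k j third<3k)))
    where
    third<3k : 2 + j * 3 < 3 * k
    third<3k = subst (2 + j * 3 <_) (*-comm k 3) (*-monoˡ-≤ 3 j<k)

goodPermutation-involutive : ∀ k u v → goodPermutation k ⟨$⟩ʳ u ≡ v → goodPermutation k ⟨$⟩ʳ v ≡ u
goodPermutation-involutive k u v σu≡v = trans (cong restriction (sym σu≡v)) (restriction-involutive u)
  where open GoodPermutation k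

mainTheorem1 : (k : ℕ) → k > 0 → Σ (Permutation′ (numVertices k)) (IsGoodPerm k)
mainTheorem1 k _ =
  goodPermutation k , goodPermutation-edges k , goodPermutation-cycles k ,
  λ u v _ → goodPermutation-involutive k u v
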